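{- Let $R=([n],\triangleright)$ be a rack and $T\subseteq[n]$. Let $C$ be the vertex set of a component of $G_T$ and let $v\in C$. Let $A\subseteq[n]$ satisfy $(A)f_i = A$ for all $i\in[n]$. Then knowledge of the maps $(f_i|_A)_{i\in T}$ and $f_v|_A$ is sufficient to determine the maps $(f_u|_A)_{u\in C}$; moreover the maps $(f_u|_A)_{u\in C}$ are all conjugate in $\mathrm{Sym}(A)$.
   Context: Maps are written on the right; a rack on $[n]$ corresponds to maps $(f_y)_{y\in[n]}$, $(x)f_y=x\triangleright y$, each a permutation of $[n]$, with $f_{(y)f_z}=f_z^{ -1}f_yf_z$ for all $y,z$. $G_T$ is the directed loopless multigraph on $[n]$ with an edge of colour $y$ from $x$ to $z$ iff $y\in T$, $x\neq z$, $(x)f_y=z$; components are those of the underlying undirected multigraph. -}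

module Defs where

open import Data.Nat using (ℕ)
open import Data.Bool using (Bool; true; false; not)
open import Data.Fin using (Fin)
open import Data.Fin.Subset using (Subset; _∈_)
open import Data.Fin.Permutation using (Permutation′; _⟨$⟩ʳ_; _⟨$⟩ˡ_)
open import Data.List using (List; []; _∷_; reverse; map)
open import Data.Product using (Σ; _×_; _,_; ∃)
open import Relation.Binary.PropositionalEquality using (_≡_; _≢_)
open import Relation.Binary.Construct.Closure.ReflexiveTransitive using (Star)
open import Relation.Binary.Construct.Closure.Symmetric using (SymClosure)

-- A rack on [n] = Fin n, given by the right-action maps f_y (x f_y = x ▷ y),
-- each a permutation of Fin n, with f_{(y) f_z} = f_z⁻¹ f_y f_z
-- (maps written on the right: x (f_z⁻¹ f_y f_z) = ((x f_z⁻¹) f_y) f_z).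
record Rack (n : ℕ) : Set where
  field
    f     : Fin n → Permutation′ n
    axiom : ∀ y z x → f (f z ⟨$⟩ʳ y) ⟨$⟩ʳ x ≡ f z ⟨$⟩ʳ (f y ⟨$⟩ʳ (f z ⟨$⟩ˡ x))

module _ {n : ℕ} (R : Rack n) where
  open Rack R

  app : Fin n → Fin n → Fin n
  app y x = f y ⟨$⟩ʳ x

  appInv : Fin n → Fin n → Fin n
  appInv y x = f y ⟨$⟩ˡ x

  Edge : Subset n → Fin n → Fin n → Set
  Edge T x z = Σ (Fin n) λ y → y ∈ T × x ≢ z × app y x ≡ z

  -- x and z lie in the same component of (the underlying undirected multigraph of) G_T.
  SameComponent : Subset n → Fin n → Fin n → Set
  SameComponent T = Star (SymClosure (Edge T))

  Invariant : Subset n → Set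
  Invariant A = ∀ i → (∀ x → x ∈ A → app i x ∈ A)
                    × (∀ a → a ∈ A → Σ (Fin n) λ x → x ∈ A × app i x ≡ a)

  -- A word in the generators f_i^{±1}: (i , true) stands for f_i, (i , false) for f_i⁻¹.
  -- Evaluated as a right action: the word g₁ g₂ … acts by x ↦ ((x g₁) g₂) …
  actWord : List (Fin n × Bool) → Fin n → Fin n
  actWord [] x = x
  actWord ((i , true) ∷ w) x = actWord w (app i x)
  actWord ((i , false) ∷ w) x = actWord w (appInv i x)

invWord : {n : ℕ} → List (Fin n × Bool) → List (Fin n × Bool)
invWord w = reverse (map (λ { (i , b) → (i , not b) }) w)

WordIn : {n : ℕ} → Subset n → List (Fin n × Bool) → Set
WordIn {n} T [] = Data.Unit.⊤ where import Data.Unit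
WordIn {n} T ((i , b) ∷ w) = i ∈ T × WordIn T w

ConjugateOn : {n : ℕ} → Subset n → (Fin n → Fin n) → (Fin n → Fin n) → Set
ConjugateOn {n} A g h =
  Σ (Fin n → Fin n) λ σ → Σ (Fin n → Fin n) λ σinv →
    (∀ x → x ∈ A → σ x ∈ A) × (∀ x → x ∈ A → σinv x ∈ A) ×
    (∀ x → x ∈ A → σinv (σ x) ≡ x) × (∀ x → x ∈ A → σ (σinv x) ≡ x) ×
    (∀ x → x ∈ A → g x ≡ σ (h (σinv x)))

module Submission where

-- Every element u in the component of v is reached from v by a
-- path of G_T, and each step along an edge of colour c ∈ T replaces the
-- current index a by (a) f_c or (a) f_c⁻¹.  By the rack axiom
-- f_{(a) f_c} = f_c⁻¹ f_a f_c, so each step conjugates f_a by a generator f_c^{±1}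
-- with c ∈ T.  Composing along the path gives a word w in the generators
-- (f_c^{±1})_{c ∈ T} with f_u = w⁻¹ f_v w; restricted to A this determines
-- f_u|_A from f_v|_A and (f_c|_A)_{c ∈ T}.  Since A is invariant, every word
-- restricts to a permutation of A, so any two f_u, f_u′ are conjugate in Sym(A).

open import Defs
open import Data.Nat using (ℕ)
open import Data.Fin using (Fin)
open import Data.Fin.Subset using (Subset; _∈_)
open import Data.Bool using (Bool; true; false; not)
open import Data.Bool.Properties using (not-involutive)
open import Data.List using (List; []; _∷_; _++_; map)
open import Data.List.Properties using (unfold-reverse; ++-assoc; ++-identityʳ)
open import Data.Unit using (tt)
open import Data.Product using (Σ; _×_; _,_; proj₁; proj₂)
open import Data.Fin.Permutation using (inverseˡ; inverseʳ)
open import Relation.Binary.PropositionalEquality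
  using (_≡_; refl; sym; trans; cong; cong₂; subst; module ≡-Reasoning)
open import Relation.Binary.Construct.Closure.ReflexiveTransitive using (ε; _◅_)
open import Relation.Binary.Construct.Closure.Symmetric using (SymClosure; fwd; bwd)

Word : ℕ → Set
Word n = List (Fin n × Bool)

-- (ℓ w)⁻¹ = w⁻¹ ℓ⁻¹ for a letter ℓ; the map inferred below is the letter flip
-- used in the definition of invWord.
invWord-∷ : ∀ {n} (i : Fin n) b (w : Word n) →
            invWord ((i , b) ∷ w) ≡ invWord w ++ ((i , not b) ∷ [])
invWord-∷ i b w = unfold-reverse (i , not b) (map _ w)

invWord-++ : ∀ {n} (w w′ : Word n) → invWord (w ++ w′) ≡ invWord w′ ++ invWord w
invWord-++ [] w′ = sym (++-identityʳ (invWord w′))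
invWord-++ ((i , b) ∷ w) w′ = begin
  invWord ((i , b) ∷ w ++ w′)                     ≡⟨ invWord-∷ i b (w ++ w′) ⟩
  invWord (w ++ w′) ++ ((i , not b) ∷ [])         ≡⟨ cong (_++ ((i , not b) ∷ [])) (invWord-++ w w′) ⟩
  (invWord w′ ++ invWord w) ++ ((i , not b) ∷ []) ≡⟨ ++-assoc (invWord w′) (invWord w) _ ⟩
  invWord w′ ++ (invWord w ++ ((i , not b) ∷ [])) ≡⟨ cong (invWord w′ ++_) (sym (invWord-∷ i b w)) ⟩
  invWord w′ ++ invWord ((i , b) ∷ w)            ∎
  where open ≡-Reasoning

invWord-involutive : ∀ {n} (w : Word n) → invWord (invWord w) ≡ w
invWord-involutive [] = refl
invWord-involutive ((i , b) ∷ w) = begin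
  invWord (invWord ((i , b) ∷ w))             ≡⟨ cong invWord (invWord-∷ i b w) ⟩
  invWord (invWord w ++ ((i , not b) ∷ []))   ≡⟨ invWord-++ (invWord w) _ ⟩
  (i , not (not b)) ∷ invWord (invWord w)     ≡⟨ cong₂ (λ b′ w′ → (i , b′) ∷ w′) (not-involutive b) (invWord-involutive w) ⟩
  (i , b) ∷ w                                 ∎
  where open ≡-Reasoning

module _ {n : ℕ} (R : Rack n) where
  open Rack R
  open ≡-Reasoning

  actWord-++ : ∀ (w w′ : Word n) x → actWord R (w ++ w′) x ≡ actWord R w′ (actWord R w x)
  actWord-++ [] w′ x = refl
  actWord-++ ((i , true) ∷ w) w′ x = actWord-++ w w′ (app R i x)
  actWord-++ ((i , false) ∷ w) w′ x = actWord-++ w w′ (appInv R i x)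

  letter-cancel : ∀ i b x → actWord R ((i , not b) ∷ []) (actWord R ((i , b) ∷ []) x) ≡ x
  letter-cancel i true x = inverseˡ (f i)
  letter-cancel i false x = inverseʳ (f i)

  actWord-cancelˡ : ∀ (w : Word n) x → actWord R (invWord w) (actWord R w x) ≡ x
  actWord-cancelˡ [] x = refl
  actWord-cancelˡ ((i , b) ∷ w) x = begin
    actWord R (invWord ((i , b) ∷ w)) (actWord R ((i , b) ∷ w) x)
      ≡⟨ cong₂ (actWord R) (invWord-∷ i b w) (actWord-++ ((i , b) ∷ []) w x) ⟩
    actWord R (invWord w ++ ((i , not b) ∷ [])) (actWord R w y)
      ≡⟨ actWord-++ (invWord w) _ _ ⟩
    actWord R ((i , not b) ∷ []) (actWord R (invWord w) (actWord R w y))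
      ≡⟨ cong (actWord R ((i , not b) ∷ [])) (actWord-cancelˡ w y) ⟩
    actWord R ((i , not b) ∷ []) y
      ≡⟨ letter-cancel i b x ⟩
    x ∎
    where
    y : Fin n
    y = actWord R ((i , b) ∷ []) x

  actWord-cancelʳ : ∀ (w : Word n) x → actWord R w (actWord R (invWord w) x) ≡ x
  actWord-cancelʳ w x =
    subst (λ w′ → actWord R w′ (actWord R (invWord w) x) ≡ x)
          (invWord-involutive w) (actWord-cancelˡ (invWord w) x)

  axiom⁻¹ : ∀ a c x → app R (appInv R c a) x ≡ appInv R c (app R a (app R c x))
  axiom⁻¹ a c x = begin
    app R a′ x
      ≡⟨ sym (inverseˡ (f c)) ⟩
    appInv R c (app R c (app R a′ x))
      ≡⟨ cong (λ t → appInv R c (app R c (app R a′ t))) (sym (inverseˡ (f c))) ⟩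
    appInv R c (app R c (app R a′ (appInv R c (app R c x))))
      ≡⟨ cong (appInv R c) (sym (axiom a′ c (app R c x))) ⟩
    appInv R c (app R (app R c a′) (app R c x))
      ≡⟨ cong (λ d → appInv R c (app R d (app R c x))) (inverseʳ (f c)) ⟩
    appInv R c (app R a (app R c x)) ∎
    where
    a′ : Fin n
    a′ = appInv R c a

  Conjugate : Word n → Fin n → Fin n → Set
  Conjugate w a b = ∀ x → app R b x ≡ actWord R w (app R a (actWord R (invWord w) x))

  conj-refl : ∀ a → Conjugate [] a a
  conj-refl a x = refl

  conj-letter : ∀ c b a → Conjugate ((c , b) ∷ []) a (actWord R ((c , b) ∷ []) a)
  conj-letter c true a x = axiom a c x
  conj-letter c false a x = axiom⁻¹ a c x

  conj-trans : ∀ {a b d} w w′ → Conjugate w a b → Conjugate w′ b d → Conjugate (w ++ w′) a d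
  conj-trans {a} {b} {d} w w′ h h′ x = begin
    app R d x
      ≡⟨ h′ x ⟩
    actWord R w′ (app R b (actWord R (invWord w′) x))
      ≡⟨ cong (actWord R w′) (h _) ⟩
    actWord R w′ (actWord R w (app R a (actWord R (invWord w) (actWord R (invWord w′) x))))
      ≡⟨ sym (actWord-++ w w′ _) ⟩
    actWord R (w ++ w′) (app R a (actWord R (invWord w) (actWord R (invWord w′) x)))
      ≡⟨ cong (λ t → actWord R (w ++ w′) (app R a t)) (sym (actWord-++ (invWord w′) (invWord w) x)) ⟩
    actWord R (w ++ w′) (app R a (actWord R (invWord w′ ++ invWord w) x))
      ≡⟨ cong (λ u → actWord R (w ++ w′) (app R a (actWord R u x))) (sym (invWord-++ w w′)) ⟩
    actWord R (w ++ w′) (app R a (actWord R (invWord (w ++ w′)) x)) ∎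

  conj-sym : ∀ {a b} w → Conjugate w a b → Conjugate (invWord w) b a
  conj-sym {a} {b} w h x = begin
    app R a x
      ≡⟨ sym (actWord-cancelˡ w _) ⟩
    actWord R (invWord w) (actWord R w (app R a x))
      ≡⟨ cong (λ t → actWord R (invWord w) (actWord R w (app R a t))) (sym (actWord-cancelˡ w x)) ⟩
    actWord R (invWord w) (actWord R w (app R a (actWord R (invWord w) (actWord R w x))))
      ≡⟨ cong (actWord R (invWord w)) (sym (h (actWord R w x))) ⟩
    actWord R (invWord w) (app R b (actWord R w x))
      ≡⟨ cong (λ u → actWord R (invWord w) (app R b (actWord R u x))) (sym (invWord-involutive w)) ⟩
    actWord R (invWord w) (app R b (actWord R (invWord (invWord w)) x)) ∎

  edge-conj : ∀ {T a b} → SymClosure (Edge R T) a b →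
              Σ (Fin n) λ c → Σ Bool λ s → c ∈ T × Conjugate ((c , s) ∷ []) a b
  edge-conj {a = a} (fwd (c , c∈T , _ , e)) =
    c , true , c∈T , subst (Conjugate ((c , true) ∷ []) a) e (conj-letter c true a)
  edge-conj {a = a} {b} (bwd (c , c∈T , _ , e)) =
    c , false , c∈T , subst (Conjugate ((c , false) ∷ []) a) b-is-moved (conj-letter c false a)
    where
    b-is-moved : appInv R c a ≡ b
    b-is-moved = trans (cong (appInv R c) (sym e)) (inverseˡ (f c))

  component-conj : ∀ T {a b} → SameComponent R T a b →
                   Σ (Word n) λ w → WordIn T w × Conjugate w a b
  component-conj T {a} ε = [] , tt , conj-refl a
  component-conj T (e ◅ p) with edge-conj e | component-conj T p
  ... | c , s , c∈T , h | w , wT , h′ = (c , s) ∷ w , (c∈T , wT) , conj-trans ((c , s) ∷ []) w h h′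

  module _ (A : Subset n) (inv : Invariant R A) where

    appInv-preserves : ∀ i a → a ∈ A → appInv R i a ∈ A
    appInv-preserves i a a∈A with proj₂ (inv i) a a∈A
    ... | x , x∈A , e = subst (_∈ A) (trans (sym (inverseˡ (f i))) (cong (appInv R i) e)) x∈A

    actWord-preserves : ∀ (w : Word n) x → x ∈ A → actWord R w x ∈ A
    actWord-preserves [] x x∈A = x∈A
    actWord-preserves ((i , true) ∷ w) x x∈A = actWord-preserves w _ (proj₁ (inv i) x x∈A)
    actWord-preserves ((i , false) ∷ w) x x∈A = actWord-preserves w _ (appInv-preserves i x x∈A)

    conj-on : ∀ {a b} w → Conjugate w a b → ConjugateOn A (app R b) (app R a)
    conj-on w h =
      actWord R w , actWord R (invWord w) ,
      actWord-preserves w , actWord-preserves (invWord w) ,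
      (λ x _ → actWord-cancelˡ w x) , (λ x _ → actWord-cancelʳ w x) ,
      (λ x _ → h x)

lemma5p3 : {n : ℕ} (R : Rack n) (T : Subset n) (v : Fin n) (A : Subset n) →
    Invariant R A →
    (∀ u → SameComponent R T v u →
       Σ (List (Fin n × Bool)) λ w → WordIn T w ×
         (∀ x → x ∈ A → app R u x ≡ actWord R w (app R v (actWord R (invWord w) x))))
    × (∀ u u′ → SameComponent R T v u → SameComponent R T v u′ →
         ConjugateOn A (app R u) (app R u′))
lemma5p3 R T v A inv = determined , conjugate
  where
  determined : ∀ u → SameComponent R T v u →
               Σ (Word _) λ w → WordIn T w ×
                 (∀ x → x ∈ A → app R u x ≡ actWord R w (app R v (actWord R (invWord w) x)))
  determined u p with component-conj R T p
  ... | w , wT , h = w , wT , λ x _ → h x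

  -- f_u′ = w′⁻¹ f_v w′ and f_u = w⁻¹ f_v w, so f_u = (w′⁻¹ w)⁻¹ f_u′ (w′⁻¹ w).
  conjugate : ∀ u u′ → SameComponent R T v u → SameComponent R T v u′ →
              ConjugateOn A (app R u) (app R u′)
  conjugate u u′ p p′ with component-conj R T p | component-conj R T p′
  ... | w , _ , h | w′ , _ , h′ = conj-on R A inv (invWord w′ ++ w) (conj-trans R (invWord w′) w (conj-sym R w′ h′) h)
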